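{- Let $R$ be a ring. Then in an $R$-graded differential category, the following equality holds: $\partial_{ -1}; \mathsf{w} = 0$.
   Context: Composition is written diagrammatically: $f;g$ means first $f$ then $g$. $R=(|R|,+,\ast,0,1)$ is a semiring (here a ring, so $-1$ exists, and $\partial_{ -1}: !_{ -1}A \otimes A \to !_{0}A$ is well-typed). An additive symmetric monoidal category is a (strict) symmetric monoidal category $(\mathcal{L},\otimes,I,\sigma)$ enriched over commutative monoids (sums $f+g$ and zero maps $0$), with composition and $\otimes$ preserving sums and zeros. An $R$-graded coalgebra modality consists of endofunctors $!_r$ ($r\in R$) and natural transformations $\mathsf{p}_{r,s}: !_{rs}A \to !_r !_s A$, $\mathsf{c}_{r,s}: !_{r+s}A \to !_rA \otimes !_sA$, $\mathsf{d}: !_1A \to A$, $\mathsf{w}: !_0A \to I$ satisfying graded comonad, graded cocommutative comonoid, and comonoid-morphism axioms for $\mathsf{p}$. An $R$-graded differential category is an additive symmetric monoidal category with an $R$-graded coalgebra modality and a deriving transformation, i.e. natural transformations $\partial_r: !_rA \otimes A \to !_{r+1}A$ satisfying: linear rule $\partial_0;\mathsf{d} = \mathsf{w}\otimes 1$; product rule $\partial_{r+s+1};\mathsf{c}_{r+1,s+1} = (\mathsf{c}_{r+1,s}\otimes 1);(1\otimes\partial_s) + (\mathsf{c}_{r,s+1}\otimes 1);(1\otimes\sigma);(\partial_r\otimes 1)$; chain rule $\partial_{rs+r+s};\mathsf{p}_{r+1,s+1} = (\mathsf{c}_{rs+r,s}\otimes 1);(\mathsf{p}_{r,s+1}\otimes\partial_s);\partial_r$;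 symmetry rule $(1\otimes\sigma);(\partial_r\otimes 1);\partial_r = (\partial_r\otimes 1);\partial_r$. -}

module Defs where

open import Level using (Level; _⊔_; suc)
open import Relation.Binary.PropositionalEquality using (_≡_; refl; subst)
open import Algebra.Structures using (IsRing)

record SetRing (c : Level) : Set (suc c) where
  infixl 6 _+_
  infixl 7 _*_
  field
    Carrier : Set c
    _+_ _*_ : Carrier → Carrier → Carrier
    -_      : Carrier → Carrier
    0# 1#   : Carrier
    isRing  : IsRing _≡_ _+_ _*_ -_ 0# 1#
  open IsRing isRing public

-- Composition _⨾_ is diagrammatic: f ⨾ g = "f then g".
record GradedDiffCat {ℓr : Level} (R : SetRing ℓr) (o h : Level)
       : Set (ℓr ⊔ suc o ⊔ suc h) where
  open SetRing R using (Carrier; _+_; _*_; 0#; 1#)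
    renaming (+-assoc to +R-assoc; +-comm to +R-comm; +-identityˡ to +R-idˡ;
              +-identityʳ to +R-idʳ; *-assoc to *R-assoc; *-identityˡ to *R-idˡ;
              *-identityʳ to *R-idʳ; zeroˡ to *R-zeroˡ; distribʳ to *R-distribʳ)
  infixr 9 _⨾_
  infixl 6 _⊹_
  infixr 10 _⊗₀_ _⊗₁_
  field
    Obj : Set o
    Hom : Obj → Obj → Set h
    id  : ∀ {A} → Hom A A
    _⨾_ : ∀ {A B C} → Hom A B → Hom B C → Hom A C
    idˡ   : ∀ {A B} (f : Hom A B) → id ⨾ f ≡ f
    idʳ   : ∀ {A B} (f : Hom A B) → f ⨾ id ≡ f
    assoc : ∀ {A B C D} (f : Hom A B) (g : Hom B C) (k : Hom C D) →
            (f ⨾ g) ⨾ k ≡ f ⨾ (g ⨾ k)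
    _⊹_   : ∀ {A B} → Hom A B → Hom A B → Hom A B
    zero  : ∀ {A B} → Hom A B
    ⊹-assoc : ∀ {A B} (f g k : Hom A B) → (f ⊹ g) ⊹ k ≡ f ⊹ (g ⊹ k)
    ⊹-comm  : ∀ {A B} (f g : Hom A B) → f ⊹ g ≡ g ⊹ f
    ⊹-idˡ   : ∀ {A B} (f : Hom A B) → zero ⊹ f ≡ f
    ⨾-⊹ˡ : ∀ {A B C} (f g : Hom A B) (k : Hom B C) → (f ⊹ g) ⨾ k ≡ (f ⨾ k) ⊹ (g ⨾ k)
    ⨾-⊹ʳ : ∀ {A B C} (k : Hom A B) (f g : Hom B C) → k ⨾ (f ⊹ g) ≡ (k ⨾ f) ⊹ (k ⨾ g)
    ⨾-zeroˡ : ∀ {A B C} (k : Hom B C) → zero {A} ⨾ k ≡ zero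
    ⨾-zeroʳ : ∀ {A B C} (k : Hom A B) → k ⨾ zero {B} {C} ≡ zero
    _⊗₀_ : Obj → Obj → Obj
    I    : Obj
    _⊗₁_ : ∀ {A B C D} → Hom A B → Hom C D → Hom (A ⊗₀ C) (B ⊗₀ D)
    ⊗-id : ∀ {A B} → id {A} ⊗₁ id {B} ≡ id
    ⊗-⨾  : ∀ {A B C D E F} (f : Hom A B) (g : Hom B C) (f' : Hom D E) (g' : Hom E F) →
           (f ⨾ g) ⊗₁ (f' ⨾ g') ≡ (f ⊗₁ f') ⨾ (g ⊗₁ g')
    ⊗-⊹ˡ : ∀ {A B C D} (f g : Hom A B) (k : Hom C D) → (f ⊹ g) ⊗₁ k ≡ (f ⊗₁ k) ⊹ (g ⊗₁ k)
    ⊗-⊹ʳ : ∀ {A B C D} (k : Hom C D) (f g : Hom A B) → k ⊗₁ (f ⊹ g) ≡ (k ⊗₁ f) ⊹ (k ⊗₁ g)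
    ⊗-zeroˡ : ∀ {A B C D} (k : Hom C D) → zero {A} {B} ⊗₁ k ≡ zero
    ⊗-zeroʳ : ∀ {A B C D} (k : Hom C D) → k ⊗₁ zero {A} {B} ≡ zero
    α  : ∀ {A B C} → Hom ((A ⊗₀ B) ⊗₀ C) (A ⊗₀ (B ⊗₀ C))
    α⁻ : ∀ {A B C} → Hom (A ⊗₀ (B ⊗₀ C)) ((A ⊗₀ B) ⊗₀ C)
    λ' : ∀ {A} → Hom (I ⊗₀ A) A
    λ⁻ : ∀ {A} → Hom A (I ⊗₀ A)
    ρ  : ∀ {A} → Hom (A ⊗₀ I) A
    ρ⁻ : ∀ {A} → Hom A (A ⊗₀ I)
    α-iso₁ : ∀ {A B C} → α {A} {B} {C} ⨾ α⁻ ≡ id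
    α-iso₂ : ∀ {A B C} → α⁻ {A} {B} {C} ⨾ α ≡ id
    λ-iso₁ : ∀ {A} → λ' {A} ⨾ λ⁻ ≡ id
    λ-iso₂ : ∀ {A} → λ⁻ {A} ⨾ λ' ≡ id
    ρ-iso₁ : ∀ {A} → ρ {A} ⨾ ρ⁻ ≡ id
    ρ-iso₂ : ∀ {A} → ρ⁻ {A} ⨾ ρ ≡ id
    α-nat : ∀ {A B C D E F} (f : Hom A B) (g : Hom C D) (k : Hom E F) →
            ((f ⊗₁ g) ⊗₁ k) ⨾ α ≡ α ⨾ (f ⊗₁ (g ⊗₁ k))
    λ-nat : ∀ {A B} (f : Hom A B) → (id {I} ⊗₁ f) ⨾ λ' ≡ λ' ⨾ f
    ρ-nat : ∀ {A B} (f : Hom A B) → (f ⊗₁ id {I}) ⨾ ρ ≡ ρ ⨾ f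
    pentagon : ∀ {A B C D} →
      (α {A} {B} {C} ⊗₁ id {D}) ⨾ α ⨾ (id ⊗₁ α) ≡ α ⨾ α
    triangle : ∀ {A B} → α {A} {I} {B} ⨾ (id ⊗₁ λ') ≡ ρ ⊗₁ id
    σ : ∀ {A B} → Hom (A ⊗₀ B) (B ⊗₀ A)
    σ-nat : ∀ {A B C D} (f : Hom A B) (g : Hom C D) → (f ⊗₁ g) ⨾ σ ≡ σ ⨾ (g ⊗₁ f)
    σ-inv : ∀ {A B} → σ {A} {B} ⨾ σ ≡ id
    hexagon : ∀ {A B C} →
      α {A} {B} {C} ⨾ σ ⨾ α ≡ (σ ⊗₁ id) ⨾ α ⨾ (id ⊗₁ σ)
    ! : Carrier → Obj → Obj
    !₁ : ∀ r {A B} → Hom A B → Hom (! r A) (! r B)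
    !-id : ∀ r {A} → !₁ r (id {A}) ≡ id
    !-⨾  : ∀ r {A B C} (f : Hom A B) (g : Hom B C) → !₁ r (f ⨾ g) ≡ !₁ r f ⨾ !₁ r g
    p : ∀ r s {A} → Hom (! (r * s) A) (! r (! s A))
    c : ∀ r s {A} → Hom (! (r + s) A) (! r A ⊗₀ ! s A)
    d : ∀ {A} → Hom (! 1# A) A
    w : ∀ {A} → Hom (! 0# A) I
    p-nat : ∀ r s {A B} (f : Hom A B) → !₁ (r * s) f ⨾ p r s ≡ p r s ⨾ !₁ r (!₁ s f)
    c-nat : ∀ r s {A B} (f : Hom A B) → !₁ (r + s) f ⨾ c r s ≡ c r s ⨾ (!₁ r f ⊗₁ !₁ s f)
    d-nat : ∀ {A B} (f : Hom A B) → !₁ 1# f ⨾ d ≡ d ⨾ f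
    w-nat : ∀ {A B} (f : Hom A B) → !₁ 0# f ⨾ w ≡ w

  idx : ∀ {r s A} → r ≡ s → Hom (! r A) (! s A)
  idx {r} {A = A} e = subst (λ t → Hom (! r A) (! t A)) e id

  field
    p-counitˡ : ∀ r {A} → p 1# r {A} ⨾ d ≡ idx (*R-idˡ r)
    p-counitʳ : ∀ r {A} → p r 1# {A} ⨾ !₁ r d ≡ idx (*R-idʳ r)
    p-coassoc : ∀ r s t {A} →
      p (r * s) t {A} ⨾ p r s ≡ idx (*R-assoc r s t) ⨾ p r (s * t) ⨾ !₁ r (p s t)
    c-coassoc : ∀ r s t {A} →
      c (r + s) t {A} ⨾ (c r s ⊗₁ id) ⨾ α ≡ idx (+R-assoc r s t) ⨾ c r (s + t) ⨾ (id ⊗₁ c s t)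
    c-counitˡ : ∀ r {A} → c 0# r {A} ⨾ (w ⊗₁ id) ⨾ λ' ≡ idx (+R-idˡ r)
    c-counitʳ : ∀ r {A} → c r 0# {A} ⨾ (id ⊗₁ w) ⨾ ρ ≡ idx (+R-idʳ r)
    c-comm : ∀ r s {A} → c r s {A} ⨾ σ ≡ idx (+R-comm r s) ⨾ c s r
    p-w : ∀ t {A} → p 0# t {A} ⨾ w ≡ idx (*R-zeroˡ t) ⨾ w
    p-c : ∀ r s t {A} →
      p (r + s) t {A} ⨾ c r s ≡ idx (*R-distribʳ t r s) ⨾ c (r * t) (s * t) ⨾ (p r t ⊗₁ p s t)
    ∂ : ∀ r {A} → Hom (! r A ⊗₀ A) (! (r + 1#) A)
    ∂-nat : ∀ r {A B} (f : Hom A B) → (!₁ r f ⊗₁ f) ⨾ ∂ r ≡ ∂ r ⨾ !₁ (r + 1#) f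
    linear-rule : ∀ {A} → ∂ 0# {A} ⨾ idx (+R-idˡ 1#) ⨾ d ≡ (w ⊗₁ id) ⨾ λ'
    product-rule : ∀ r s {A} (e : (r + s) + 1# + 1# ≡ (r + 1#) + (s + 1#))
                   (e₁ : (r + s) + 1# ≡ (r + 1#) + s) (e₂ : (r + s) + 1# ≡ r + (s + 1#)) →
      ∂ ((r + s) + 1#) {A} ⨾ idx e ⨾ c (r + 1#) (s + 1#)
        ≡ ((idx e₁ ⨾ c (r + 1#) s) ⊗₁ id) ⨾ α ⨾ (id ⊗₁ ∂ s)
          ⊹ ((idx e₂ ⨾ c r (s + 1#)) ⊗₁ id) ⨾ α ⨾ (id ⊗₁ σ) ⨾ α⁻ ⨾ (∂ r ⊗₁ id)
    chain-rule : ∀ r s {A} (e : (r * s + r) + s + 1# ≡ (r + 1#) * (s + 1#))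
                 (e₁ : r * s + r ≡ r * (s + 1#)) →
      ∂ ((r * s + r) + s) {A} ⨾ idx e ⨾ p (r + 1#) (s + 1#)
        ≡ (c (r * s + r) s ⊗₁ id) ⨾ α ⨾ ((idx e₁ ⨾ p r (s + 1#)) ⊗₁ ∂ s) ⨾ ∂ r
    symmetry-rule : ∀ r {A} →
      α ⨾ (id ⊗₁ σ) ⨾ α⁻ ⨾ (∂ r {A} ⊗₁ id) ⨾ ∂ (r + 1#)
        ≡ (∂ r ⊗₁ id) ⨾ ∂ (r + 1#)

-- By naturality of w we have w = !₀(0) ; w.  Pushing !(0) back through the
-- grade transport and, by naturality of ∂, into the input of ∂ makes the second
-- tensor factor the zero map, and ⊗ and composition preserve zero.  The ring
-- structure is only needed so that the grade −1 + 1 is 0.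
module Submission where

open import Defs
open import Level using (Level)
open import Relation.Binary.PropositionalEquality using (_≡_; refl; sym; trans; cong; module ≡-Reasoning)

module _ {c o h : Level} {R : SetRing c} (D : GradedDiffCat R o h) where
  open SetRing R using (Carrier; _+_; 0#; 1#)
  open GradedDiffCat D
  open ≡-Reasoning

  idx-!₁ : ∀ {a b : Carrier} {A B} (e : a ≡ b) (f : Hom A B) →
           idx e ⨾ !₁ b f ≡ !₁ a f ⨾ idx e
  idx-!₁ refl f = trans (idˡ (!₁ _ f)) (sym (idʳ (!₁ _ f)))

  ∂-!₁-zero : ∀ r {A B} → ∂ r {A} ⨾ !₁ (r + 1#) (zero {A} {B}) ≡ zero
  ∂-!₁-zero r = begin
      ∂ r ⨾ !₁ (r + 1#) zero     ≡⟨ sym (∂-nat r zero) ⟩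
      (!₁ r zero ⊗₁ zero) ⨾ ∂ r  ≡⟨ cong (_⨾ ∂ r) (⊗-zeroʳ (!₁ r zero)) ⟩
      zero ⨾ ∂ r                 ≡⟨ ⨾-zeroˡ (∂ r) ⟩
      zero                       ∎

  ∂-transport-w : ∀ r {A} (e : r + 1# ≡ 0#) → ∂ r {A} ⨾ (idx e ⨾ w) ≡ zero
  ∂-transport-w r {A} e = begin
      ∂ r ⨾ (idx e ⨾ w)                      ≡⟨ cong (λ x → ∂ r ⨾ (idx e ⨾ x)) (sym (w-nat (zero {A} {A}))) ⟩
      ∂ r ⨾ (idx e ⨾ (!₁ 0# zero ⨾ w))       ≡⟨ cong (∂ r ⨾_) (sym (assoc _ _ _)) ⟩
      ∂ r ⨾ ((idx e ⨾ !₁ 0# zero) ⨾ w)       ≡⟨ cong (λ x → ∂ r ⨾ (x ⨾ w)) (idx-!₁ e zero) ⟩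
      ∂ r ⨾ ((!₁ (r + 1#) zero ⨾ idx e) ⨾ w) ≡⟨ cong (∂ r ⨾_) (assoc _ _ _) ⟩
      ∂ r ⨾ (!₁ (r + 1#) zero ⨾ (idx e ⨾ w)) ≡⟨ sym (assoc _ _ _) ⟩
      (∂ r ⨾ !₁ (r + 1#) zero) ⨾ (idx e ⨾ w) ≡⟨ cong (_⨾ (idx e ⨾ w)) (∂-!₁-zero r) ⟩
      zero ⨾ (idx e ⨾ w)                     ≡⟨ ⨾-zeroˡ _ ⟩
      zero                                   ∎

lemma3p2 : ∀ {c o h : Level} (R : SetRing c) (D : GradedDiffCat R o h) {A : GradedDiffCat.Obj D} →
    GradedDiffCat._⨾_ D (GradedDiffCat.∂ D (SetRing.-_ R (SetRing.1# R)) {A})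
      (GradedDiffCat._⨾_ D (GradedDiffCat.idx D (SetRing.-‿inverseˡ R (SetRing.1# R)))
        (GradedDiffCat.w D))
    ≡ GradedDiffCat.zero D
lemma3p2 R D = ∂-transport-w D (SetRing.-_ R (SetRing.1# R)) (SetRing.-‿inverseˡ R (SetRing.1# R))
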